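{- Let $A = \{a_1, a_2, a_3, a_4\}$ be a set of odd positive integers with $a_1 < a_2 < a_3 < a_4$. Then $|4^{\wedge}_{\pm}A| = 15$ if and only if either $A = \{a_1, a_2, a_3, a_3 + a_2 + a_1\}$ or $A = \{a_1, a_2, a_3, a_3 + a_2 - a_1\}$.
   Context: For a finite set $A = \{a_1, \ldots, a_k\}$ of integers (with distinct $a_i$) and a positive integer $h$, the restricted $h$-fold signed sumset is \[h^{\wedge}_{\pm}A = \left\{ \sum_{i=1}^{k} \lambda_i a_i : \lambda_i \in \{ -1,0,1\}, \ \sum_{i=1}^{k} |\lambda_i| = h \right\}.\] -}

module Defs where

open import Data.Nat using (ℕ; zero; suc)
open import Data.Integer using (ℤ; +_; _+_; -_; _≟_)
open import Data.List using (List; []; _∷_; _++_; map; concatMap; length; deduplicate)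
open import Data.List.Membership.Propositional using (_∈_)
open import Data.Product using (_×_)

data Sign : Set where
  neg zer pos : Sign

weight : Sign → ℕ
weight zer = 0
weight _   = 1

act : Sign → ℤ → ℤ
act neg a = - a
act zer a = + 0
act pos a = a

-- restricted h-fold signed sumset of the list a_1,…,a_k (as a list,
-- possibly with repetitions):
-- all sums Σ λ_i a_i with λ_i ∈ {-1,0,1} and Σ |λ_i| = h
signedSums : ℕ → List ℤ → List ℤ
signedSums zero    []       = + 0 ∷ []
signedSums (suc h) []       = []
signedSums zero    (a ∷ as) = signedSums zero as
signedSums (suc h) (a ∷ as) =
  signedSums (suc h) as
  ++ map (λ x → act neg a + x) (signedSums h as)
  ++ map (λ x → act pos a + x) (signedSums h as)

card-signed : ℕ → List ℤ → ℕ
card-signed h as = length (deduplicate _≟_ (signedSums h as))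

_≈set_ : List ℤ → List ℤ → Set
xs ≈set ys = (∀ x → x ∈ xs → x ∈ ys) × (∀ y → y ∈ ys → y ∈ xs)

{-# OPTIONS --safe #-}
module Submission where

-- Write the odd numbers 0 < a₁ < a₂ < a₃ < a₄ as aᵢ = 2i − 1 + 2(q₁ + ⋯ + qᵢ)
-- with qᵢ ∈ ℕ, so that each of the 16 signed sums ±a₁ ± a₂ ± a₃ ± a₄ is the value
-- at q of an affine form with integer coefficients. The difference of two such
-- forms is twice a form E, and E cannot vanish at q if its constant is positive
-- and its coefficients are non-negative (or the same holds for −E), if its
-- constant is odd, or, when a₄ ≠ a₃ + a₂ ± a₁, if E = ±(a₄ − (a₃ + a₂ ± a₁)).
-- Evaluation shows that every pair of distinct forms is separated in one of
-- these ways, so the 16 sums are distinct unless a₄ = a₃ + a₂ ± a₁; in each of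
-- those two cases exactly one pair of forms coincides, leaving 15 values.

open import Defs
open import Data.Nat using (ℕ; zero; suc)
open import Data.Nat.Properties using (m+n≡0⇒m≡0)
open import Data.Integer
  using (ℤ; +_; -[1+_]; -_; _+_; _-_; _*_; _<_; _≤_; _<?_; _≤?_; _≟_; ∣_∣; -<+)
open import Data.Integer.Properties
  using (<⇒≢; <⇒≱; ≰⇒>; <-trans; +-mono-≤; +-mono-<-≤; +-monoˡ-≤; *-monoˡ-≤-nonNeg;
         *-monoʳ-≤-nonNeg; i-j≡0⇒i≡j; i≤j⇒0≤j-i; i<j⇒suc[i]≤j; 0≤i⇒+∣i∣≡i; +-inverseʳ;
         +-identityˡ; ≤-refl)
open import Data.Integer.DivMod using (_/_)
open import Data.Integer.Divisibility.Signed
  using (_∣_; _∣?_; divides; ∣-refl; ∣m⇒∣m*n; ∣m+n∣n⇒∣m)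
open import Data.Integer.Tactic.RingSolver using (solve-∀)
open import Data.List using (List; []; _∷_; _++_; _∷ʳ_; map; filter; length; deduplicate)
open import Data.List.Properties using (map-++; length-map)
open import Data.List.Membership.Propositional using (_∈_; _∉_)
open import Data.List.Membership.Propositional.Properties using (∈-++⁺ʳ; ∈-++⁻; ∈-deduplicate⁻)
open import Data.List.Membership.DecPropositional using () renaming (_∈?_ to ∈?)
open import Data.List.Relation.Unary.All as All using (All; []; _∷_)
open import Data.List.Relation.Unary.All.Properties using (All¬⇒¬Any)
open import Data.List.Relation.Unary.Any using (here; there)
open import Data.Product using (_×_; _,_; proj₁; ∃)
open import Data.Product.Properties using () renaming (≡-dec to ×-≡-dec)
open import Data.Sum using (_⊎_; inj₁; inj₂; [_,_])
open import Data.Sum.Function.Propositional using (_⊎-⇔_)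
open import Data.Unit using (tt)
open import Data.Vec as Vec using (Vec; []; _∷_; zipWith; replicate)
open import Data.Vec.Properties using () renaming (≡-dec to Vec-≡-dec)
open import Data.Vec.Relation.Unary.All as VecAll using ([]; _∷_)
open import Data.Empty using (⊥-elim)
open import Function using (_∘_; _⇔_; mk⇔)
open import Function.Properties.Equivalence using () renaming (trans to ⇔-trans; sym to ⇔-sym)
open import Relation.Nullary using (Dec; yes; no; ¬_; ¬?; _×-dec_; _⊎-dec_; contradiction)
open import Relation.Nullary.Decidable using (toWitness; decidable-stable)
open import Relation.Binary.Definitions using (DecidableEquality)
open import Relation.Binary.PropositionalEquality
  using (_≡_; _≢_; refl; sym; trans; cong; cong₂; subst; ≢-sym; module ≡-Reasoning)

open ≡-Reasoning

module SignedSumset {A : Set} (0# : A) (neg : A → A) (_∙_ : A → A → A) where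

  sumset : ℕ → List A → List A
  sumset zero    []       = 0# ∷ []
  sumset (suc h) []       = []
  sumset zero    (a ∷ as) = sumset zero as
  sumset (suc h) (a ∷ as) =
    sumset (suc h) as ++ map (neg a ∙_) (sumset h as) ++ map (a ∙_) (sumset h as)

  module _ (f : A → ℤ) (f-0# : f 0# ≡ + 0) (f-neg : ∀ x → f (neg x) ≡ - f x)
           (f-∙ : ∀ x y → f (x ∙ y) ≡ f x + f y) where

    map-translate : ∀ b xs → map f (map (b ∙_) xs) ≡ map (λ y → f b + y) (map f xs)
    map-translate b []       = refl
    map-translate b (x ∷ xs) = cong₂ _∷_ (f-∙ b x) (map-translate b xs)

    map-sumset : ∀ h as → map f (sumset h as) ≡ signedSums h (map f as)
    map-sumset zero    []       = cong (_∷ []) f-0#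
    map-sumset (suc h) []       = refl
    map-sumset zero    (a ∷ as) = map-sumset zero as
    map-sumset (suc h) (a ∷ as) = begin
        map f (S′ ++ map (neg a ∙_) S ++ map (a ∙_) S)
      ≡⟨ map-++ f S′ _ ⟩
        map f S′ ++ map f (map (neg a ∙_) S ++ map (a ∙_) S)
      ≡⟨ cong (map f S′ ++_) (map-++ f (map (neg a ∙_) S) _) ⟩
        map f S′ ++ map f (map (neg a ∙_) S) ++ map f (map (a ∙_) S)
      ≡⟨ cong₂ _++_ (map-sumset (suc h) as)
                    (cong₂ _++_ (map-translate (neg a) S) (map-translate a S)) ⟩
        signedSums (suc h) (map f as)
          ++ map (λ y → f (neg a) + y) (map f S) ++ map (λ y → f a + y) (map f S)
      ≡⟨ cong₂ (λ c T → signedSums (suc h) (map f as) ++ map (λ y → c + y) T ++ map (λ y → f a + y) T)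
               (f-neg a) (map-sumset h as) ⟩
        signedSums (suc h) (map f (a ∷ as))
      ∎
      where
      S = sumset h as
      S′ = sumset (suc h) as

InjectiveOn : {A B : Set} → (A → B) → List A → Set
InjectiveOn f xs = ∀ {x y} → x ∈ xs → y ∈ xs → f x ≡ f y → x ≡ y

module _ {A B : Set} (_≟ᴬ_ : DecidableEquality A) (_≟ᴮ_ : DecidableEquality B) (f : A → B) where

  filter-≢-map : ∀ x ys → (∀ {y} → y ∈ ys → f x ≡ f y → x ≡ y) →
    filter (¬? ∘ (f x ≟ᴮ_)) (map f ys) ≡ map f (filter (¬? ∘ (x ≟ᴬ_)) ys)
  filter-≢-map x []       inj = refl
  filter-≢-map x (y ∷ ys) inj with f x ≟ᴮ f y | x ≟ᴬ y
  ... | yes _     | yes _   = filter-≢-map x ys (inj ∘ there)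
  ... | yes fx≡fy | no x≢y  = contradiction (inj (here refl) fx≡fy) x≢y
  ... | no fx≢fy  | yes x≡y = contradiction (cong f x≡y) fx≢fy
  ... | no _      | no _    = cong (f y ∷_) (filter-≢-map x ys (inj ∘ there))

  deduplicate-map : ∀ xs → InjectiveOn f xs →
    deduplicate _≟ᴮ_ (map f xs) ≡ map f (deduplicate _≟ᴬ_ xs)
  deduplicate-map []       inj = refl
  deduplicate-map (x ∷ xs) inj = cong (f x ∷_) (begin
      filter (¬? ∘ (f x ≟ᴮ_)) (deduplicate _≟ᴮ_ (map f xs))
    ≡⟨ cong (filter (¬? ∘ (f x ≟ᴮ_))) (deduplicate-map xs (λ x∈ y∈ → inj (there x∈) (there y∈))) ⟩
      filter (¬? ∘ (f x ≟ᴮ_)) (map f (deduplicate _≟ᴬ_ xs))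
    ≡⟨ filter-≢-map x _ (λ y∈ → inj (here refl) (there (∈-deduplicate⁻ _≟ᴬ_ xs y∈))) ⟩
      map f (filter (¬? ∘ (x ≟ᴬ_)) (deduplicate _≟ᴬ_ xs))
    ∎)

  length-deduplicate-map : ∀ xs → InjectiveOn f xs →
    length (deduplicate _≟ᴮ_ (map f xs)) ≡ length (deduplicate _≟ᴬ_ xs)
  length-deduplicate-map xs inj =
    trans (cong length (deduplicate-map xs inj)) (length-map f (deduplicate _≟ᴬ_ xs))

LinForm : ℕ → Set
LinForm n = ℤ × Vec ℤ n

private variable n : ℕ

infix  4 _≟ᶠ_
infixl 6 _⊕_ _⊖_
infix  8 ⊝_

_≟ᶠ_ : DecidableEquality (LinForm n)
_≟ᶠ_ = ×-≡-dec _≟_ (Vec-≡-dec _≟_)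

_⊕_ : LinForm n → LinForm n → LinForm n
(c , cs) ⊕ (d , ds) = c + d , zipWith _+_ cs ds

⊝_ : LinForm n → LinForm n
⊝ (c , cs) = - c , Vec.map -_ cs

_⊖_ : LinForm n → LinForm n → LinForm n
F ⊖ G = F ⊕ ⊝ G

𝟘 : LinForm n
𝟘 = + 0 , replicate _ (+ 0)

halve : LinForm n → LinForm n
halve (c , cs) = c / + 2 , Vec.map (_/ + 2) cs

signedSumsᶠ : ℕ → List (LinForm n) → List (LinForm n)
signedSumsᶠ = SignedSumset.sumset 𝟘 ⊝_ _⊕_

infix 7 _·_

_·_ : Vec ℤ n → Vec ℕ n → ℤ
[]       · []       = + 0
(c ∷ cs) · (x ∷ xs) = c * + x + cs · xs

⟦_⟧ : LinForm n → Vec ℕ n → ℤ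
⟦ c , cs ⟧ q = c + + 2 * (cs · q)

·-zipWith-+ : ∀ (cs ds : Vec ℤ n) q → zipWith _+_ cs ds · q ≡ cs · q + ds · q
·-zipWith-+ []       []       []      = refl
·-zipWith-+ (c ∷ cs) (d ∷ ds) (x ∷ q) = begin
    (c + d) * + x + zipWith _+_ cs ds · q  ≡⟨ cong (λ s → (c + d) * + x + s) (·-zipWith-+ cs ds q) ⟩
    (c + d) * + x + (cs · q + ds · q)      ≡⟨ distrib c d (+ x) (cs · q) (ds · q) ⟩
    c * + x + cs · q + (d * + x + ds · q)  ∎
  where
  distrib : ∀ c d x s t → (c + d) * x + (s + t) ≡ c * x + s + (d * x + t)
  distrib = solve-∀

·-map-neg : ∀ (cs : Vec ℤ n) q → Vec.map -_ cs · q ≡ - (cs · q)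
·-map-neg []       []      = refl
·-map-neg (c ∷ cs) (x ∷ q) =
  trans (cong (λ s → - c * + x + s) (·-map-neg cs q)) (neg-distrib c (+ x) (cs · q))
  where
  neg-distrib : ∀ c x s → - c * x + - s ≡ - (c * x + s)
  neg-distrib = solve-∀

·-replicate-0 : ∀ (q : Vec ℕ n) → replicate n (+ 0) · q ≡ + 0
·-replicate-0 []      = refl
·-replicate-0 (x ∷ q) = trans (+-identityˡ _) (·-replicate-0 q)

·-nonNeg : ∀ {cs : Vec ℤ n} q → VecAll.All (+ 0 ≤_) cs → + 0 ≤ cs · q
·-nonNeg []      []          = ≤-refl
·-nonNeg (x ∷ q) (0≤c ∷ 0≤cs) = +-mono-≤ (*-monoʳ-≤-nonNeg (+ x) 0≤c) (·-nonNeg q 0≤cs)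

module _ (q : Vec ℕ n) where

  ⟦⟧-⊕ : ∀ F G → ⟦ F ⊕ G ⟧ q ≡ ⟦ F ⟧ q + ⟦ G ⟧ q
  ⟦⟧-⊕ (c , cs) (d , ds) = begin
      c + d + + 2 * (zipWith _+_ cs ds · q)  ≡⟨ cong (λ s → c + d + + 2 * s) (·-zipWith-+ cs ds q) ⟩
      c + d + + 2 * (cs · q + ds · q)        ≡⟨ distrib c d (cs · q) (ds · q) ⟩
      c + + 2 * (cs · q) + (d + + 2 * (ds · q)) ∎
    where
    distrib : ∀ c d s t → c + d + + 2 * (s + t) ≡ c + + 2 * s + (d + + 2 * t)
    distrib = solve-∀

  ⟦⟧-⊝ : ∀ F → ⟦ ⊝ F ⟧ q ≡ - ⟦ F ⟧ q
  ⟦⟧-⊝ (c , cs) = trans (cong (λ s → - c + + 2 * s) (·-map-neg cs q)) (neg-distrib c (cs · q))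
    where
    neg-distrib : ∀ c s → - c + + 2 * - s ≡ - (c + + 2 * s)
    neg-distrib = solve-∀

  ⟦⟧-𝟘 : ⟦ 𝟘 {n} ⟧ q ≡ + 0
  ⟦⟧-𝟘 = cong (λ s → + 0 + + 2 * s) (·-replicate-0 q)

  ⟦⟧-⊖ : ∀ F G → ⟦ F ⊖ G ⟧ q ≡ ⟦ F ⟧ q - ⟦ G ⟧ q
  ⟦⟧-⊖ F G = trans (⟦⟧-⊕ F (⊝ G)) (cong (λ v → ⟦ F ⟧ q + v) (⟦⟧-⊝ G))

  ⟦⟧-signedSumsᶠ : ∀ h Fs →
    map (λ F → ⟦ F ⟧ q) (signedSumsᶠ h Fs) ≡ signedSums h (map (λ F → ⟦ F ⟧ q) Fs)
  ⟦⟧-signedSumsᶠ = SignedSumset.map-sumset 𝟘 ⊝_ _⊕_ (λ F → ⟦ F ⟧ q) ⟦⟧-𝟘 ⟦⟧-⊝ ⟦⟧-⊕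

Positive : LinForm n → Set
Positive (c , cs) = + 0 < c × VecAll.All (+ 0 ≤_) cs

positive? : (F : LinForm n) → Dec (Positive F)
positive? (c , cs) = + 0 <? c ×-dec VecAll.all? (+ 0 ≤?_) cs

ManifestlyNonzero : List (LinForm n) → LinForm n → Set
ManifestlyNonzero extra E = Positive E ⊎ ¬ (+ 2 ∣ proj₁ E) ⊎ E ∈ extra

manifestlyNonzero? : (extra : List (LinForm n)) (E : LinForm n) →
  Dec (ManifestlyNonzero extra E)
manifestlyNonzero? extra E = positive? E ⊎-dec ¬? (+ 2 ∣? proj₁ E) ⊎-dec ∈? _≟ᶠ_ E extra

Separated : List (LinForm n) → LinForm n → LinForm n → Set
Separated extra F G =
  F ≡ G ⊎ (F ⊖ G ≡ E ⊕ E × (ManifestlyNonzero extra E ⊎ ManifestlyNonzero extra (⊝ E)))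
  where E = halve (F ⊖ G)

separated? : (extra : List (LinForm n)) (F G : LinForm n) → Dec (Separated extra F G)
separated? extra F G =
  F ≟ᶠ G ⊎-dec
  (F ⊖ G ≟ᶠ E ⊕ E ×-dec (manifestlyNonzero? extra E ⊎-dec manifestlyNonzero? extra (⊝ E)))
  where E = halve (F ⊖ G)

AllSeparated : List (LinForm n) → List (LinForm n) → Set
AllSeparated extra Fs = All (λ F → All (Separated extra F) Fs) Fs

allSeparated? : (extra Fs : List (LinForm n)) → Dec (AllSeparated extra Fs)
allSeparated? extra Fs = All.all? (λ F → All.all? (separated? extra F) Fs) Fs

i+i≡0⇒i≡0 : ∀ i → i + i ≡ + 0 → i ≡ + 0
i+i≡0⇒i≡0 (+ n)    eq = cong +_ (m+n≡0⇒m≡0 n (cong ∣_∣ eq))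
i+i≡0⇒i≡0 -[1+ n ] ()

module _ (q : Vec ℕ n) where

  positive-sound : ∀ {F} → Positive F → + 0 < ⟦ F ⟧ q
  positive-sound (0<c , 0≤cs) = +-mono-<-≤ 0<c (*-monoˡ-≤-nonNeg (+ 2) (·-nonNeg q 0≤cs))

  ⟦⟧≡0⇒2∣constant : ∀ F → ⟦ F ⟧ q ≡ + 0 → + 2 ∣ proj₁ F
  ⟦⟧≡0⇒2∣constant (c , cs) eq =
    ∣m+n∣n⇒∣m (subst (+ 2 ∣_) (sym eq) (divides (+ 0) refl)) (∣m⇒∣m*n (cs · q) ∣-refl)

  module _ {extra : List (LinForm n)} (extra≢0 : All (λ E → ⟦ E ⟧ q ≢ + 0) extra) where

    manifestlyNonzero-sound : ∀ {E} → ManifestlyNonzero extra E → ⟦ E ⟧ q ≢ + 0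
    manifestlyNonzero-sound (inj₁ E-pos)        = ≢-sym (<⇒≢ (positive-sound E-pos))
    manifestlyNonzero-sound {E} (inj₂ (inj₁ odd)) = odd ∘ ⟦⟧≡0⇒2∣constant E
    manifestlyNonzero-sound (inj₂ (inj₂ E∈))    = All.lookup extra≢0 E∈

    separated-sound : ∀ {F G} → Separated extra F G → ⟦ F ⟧ q ≡ ⟦ G ⟧ q → F ≡ G
    separated-sound (inj₁ F≡G)                _  = F≡G
    separated-sound {F} {G} (inj₂ (D≡E⊕E , nz)) eq = ⊥-elim (nonzero nz (i+i≡0⇒i≡0 _ (begin
        ⟦ E ⟧ q + ⟦ E ⟧ q   ≡⟨ ⟦⟧-⊕ q E E ⟨
        ⟦ E ⊕ E ⟧ q         ≡⟨ cong (λ D → ⟦ D ⟧ q) D≡E⊕E ⟨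
        ⟦ F ⊖ G ⟧ q         ≡⟨ ⟦⟧-⊖ q F G ⟩
        ⟦ F ⟧ q - ⟦ G ⟧ q   ≡⟨ cong (λ v → v - ⟦ G ⟧ q) eq ⟩
        ⟦ G ⟧ q - ⟦ G ⟧ q   ≡⟨ +-inverseʳ (⟦ G ⟧ q) ⟩
        + 0                 ∎)))
      where
      E = halve (F ⊖ G)
      nonzero : ManifestlyNonzero extra E ⊎ ManifestlyNonzero extra (⊝ E) → ⟦ E ⟧ q ≢ + 0
      nonzero (inj₁ nz-E)  = manifestlyNonzero-sound nz-E
      nonzero (inj₂ nz-⊝E) eq₀ = manifestlyNonzero-sound nz-⊝E (trans (⟦⟧-⊝ q E) (cong -_ eq₀))

    allSeparated-injective : ∀ {Fs} → AllSeparated extra Fs → InjectiveOn (λ F → ⟦ F ⟧ q) Fs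
    allSeparated-injective sep F∈ G∈ = separated-sound (All.lookup (All.lookup sep F∈) G∈)

    card-signed-⟦⟧ : ∀ h Fs → AllSeparated extra (signedSumsᶠ h Fs) →
      card-signed h (map (λ F → ⟦ F ⟧ q) Fs) ≡ length (deduplicate _≟ᶠ_ (signedSumsᶠ h Fs))
    card-signed-⟦⟧ h Fs sep = begin
        length (deduplicate _≟_ (signedSums h (map (λ F → ⟦ F ⟧ q) Fs)))
      ≡⟨ cong (length ∘ deduplicate _≟_) (⟦⟧-signedSumsᶠ q h Fs) ⟨
        length (deduplicate _≟_ (map (λ F → ⟦ F ⟧ q) (signedSumsᶠ h Fs)))
      ≡⟨ length-deduplicate-map _≟ᶠ_ _≟_ (λ F → ⟦ F ⟧ q) _ (allSeparated-injective sep) ⟩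
        length (deduplicate _≟ᶠ_ (signedSumsᶠ h Fs))
      ∎

A₁ A₂ A₃ A₄ A₄⁺ A₄⁻ : LinForm 4
A₁ = + 1 , + 1 ∷ + 0 ∷ + 0 ∷ + 0 ∷ []
A₂ = + 3 , + 1 ∷ + 1 ∷ + 0 ∷ + 0 ∷ []
A₃ = + 5 , + 1 ∷ + 1 ∷ + 1 ∷ + 0 ∷ []
A₄ = + 7 , + 1 ∷ + 1 ∷ + 1 ∷ + 1 ∷ []
A₄⁺ = A₃ ⊕ A₂ ⊕ A₁
A₄⁻ = A₃ ⊕ A₂ ⊖ A₁

odd-gap : ∀ {a b} → (∃ λ k → a ≡ + 2 * k + + 1) → (∃ λ l → b ≡ + 2 * l + + 1) →
  a < b → ∃ λ q → b ≡ a + + 2 + + 2 * + q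
odd-gap (k , refl) (l , refl) 2k+1<2l+1 = ∣ l - (+ 1 + k) ∣ , (begin
    + 2 * l + + 1
  ≡⟨ split k l ⟩
    + 2 * k + + 1 + + 2 + + 2 * (l - (+ 1 + k))
  ≡⟨ cong (λ d → + 2 * k + + 1 + + 2 + + 2 * d) (0≤i⇒+∣i∣≡i 0≤l-1-k) ⟨
    + 2 * k + + 1 + + 2 + + 2 * + ∣ l - (+ 1 + k) ∣
  ∎)
  where
  k<l : k < l
  k<l = ≰⇒> λ l≤k → <⇒≱ 2k+1<2l+1 (+-monoˡ-≤ (+ 1) (*-monoˡ-≤-nonNeg (+ 2) l≤k))
  0≤l-1-k = i≤j⇒0≤j-i (i<j⇒suc[i]≤j k<l)
  split : ∀ k l → + 2 * l + + 1 ≡ + 2 * k + + 1 + + 2 + + 2 * (l - (+ 1 + k))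
  split = solve-∀

odd-increasing-parametrisation : ∀ {a₁ a₂ a₃ a₄} →
  (∃ λ k₁ → a₁ ≡ + 2 * k₁ + + 1) → (∃ λ k₂ → a₂ ≡ + 2 * k₂ + + 1) →
  (∃ λ k₃ → a₃ ≡ + 2 * k₃ + + 1) → (∃ λ k₄ → a₄ ≡ + 2 * k₄ + + 1) →
  + 0 < a₁ → a₁ < a₂ → a₂ < a₃ → a₃ < a₄ →
  ∃ λ q → a₁ ≡ ⟦ A₁ ⟧ q × a₂ ≡ ⟦ A₂ ⟧ q × a₃ ≡ ⟦ A₃ ⟧ q × a₄ ≡ ⟦ A₄ ⟧ q
odd-increasing-parametrisation odd₁ odd₂ odd₃ odd₄ 0<a₁ a₁<a₂ a₂<a₃ a₃<a₄
  -- −1 = 2 · (−1) + 1 is an odd number below a₁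
  with q₁ , refl ← odd-gap (- + 1 , refl) odd₁ (<-trans -<+ 0<a₁)
  with q₂ , refl ← odd-gap odd₁ odd₂ a₁<a₂
  with q₃ , refl ← odd-gap odd₂ odd₃ a₂<a₃
  with q₄ , refl ← odd-gap odd₃ odd₄ a₃<a₄
  = q₁ ∷ q₂ ∷ q₃ ∷ q₄ ∷ []
  , a₁≡ (+ q₁) (+ q₂) (+ q₃) (+ q₄) , a₂≡ (+ q₁) (+ q₂) (+ q₃) (+ q₄)
  , a₃≡ (+ q₁) (+ q₂) (+ q₃) (+ q₄) , a₄≡ (+ q₁) (+ q₂) (+ q₃) (+ q₄)
  where
  a₁≡ : ∀ x₁ x₂ x₃ x₄ → - + 1 + + 2 + + 2 * x₁
    ≡ + 1 + + 2 * (+ 1 * x₁ + (+ 0 * x₂ + (+ 0 * x₃ + (+ 0 * x₄ + + 0))))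
  a₁≡ = solve-∀
  a₂≡ : ∀ x₁ x₂ x₃ x₄ → - + 1 + + 2 + + 2 * x₁ + + 2 + + 2 * x₂
    ≡ + 3 + + 2 * (+ 1 * x₁ + (+ 1 * x₂ + (+ 0 * x₃ + (+ 0 * x₄ + + 0))))
  a₂≡ = solve-∀
  a₃≡ : ∀ x₁ x₂ x₃ x₄ → - + 1 + + 2 + + 2 * x₁ + + 2 + + 2 * x₂ + + 2 + + 2 * x₃
    ≡ + 5 + + 2 * (+ 1 * x₁ + (+ 1 * x₂ + (+ 1 * x₃ + (+ 0 * x₄ + + 0))))
  a₃≡ = solve-∀
  a₄≡ : ∀ x₁ x₂ x₃ x₄ → - + 1 + + 2 + + 2 * x₁ + + 2 + + 2 * x₂ + + 2 + + 2 * x₃ + + 2 + + 2 * x₄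
    ≡ + 7 + + 2 * (+ 1 * x₁ + (+ 1 * x₂ + (+ 1 * x₃ + (+ 1 * x₄ + + 0))))
  a₄≡ = solve-∀

module _ (q : Vec ℕ 4) where

  card-signed-A : ℤ → ℕ
  card-signed-A a₄ = card-signed 4 (⟦ A₁ ⟧ q ∷ ⟦ A₂ ⟧ q ∷ ⟦ A₃ ⟧ q ∷ a₄ ∷ [])

  a₃+a₂+a₁ a₃+a₂-a₁ : ℤ
  a₃+a₂+a₁ = ⟦ A₃ ⟧ q + ⟦ A₂ ⟧ q + ⟦ A₁ ⟧ q
  a₃+a₂-a₁ = ⟦ A₃ ⟧ q + ⟦ A₂ ⟧ q - ⟦ A₁ ⟧ q

  ⟦A₄⁺⟧ : ⟦ A₄⁺ ⟧ q ≡ a₃+a₂+a₁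
  ⟦A₄⁺⟧ = trans (⟦⟧-⊕ q (A₃ ⊕ A₂) A₁) (cong (λ v → v + ⟦ A₁ ⟧ q) (⟦⟧-⊕ q A₃ A₂))

  ⟦A₄⁻⟧ : ⟦ A₄⁻ ⟧ q ≡ a₃+a₂-a₁
  ⟦A₄⁻⟧ = trans (⟦⟧-⊖ q (A₃ ⊕ A₂) A₁) (cong (λ v → v - ⟦ A₁ ⟧ q) (⟦⟧-⊕ q A₃ A₂))

  card-signed-A₄⁺ : card-signed-A a₃+a₂+a₁ ≡ 15
  card-signed-A₄⁺ = subst (λ a → card-signed-A a ≡ 15) ⟦A₄⁺⟧
    (card-signed-⟦⟧ q [] 4 Fs (toWitness {a? = allSeparated? [] (signedSumsᶠ 4 Fs)} tt))
    where Fs = A₁ ∷ A₂ ∷ A₃ ∷ A₄⁺ ∷ []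

  card-signed-A₄⁻ : card-signed-A a₃+a₂-a₁ ≡ 15
  card-signed-A₄⁻ = subst (λ a → card-signed-A a ≡ 15) ⟦A₄⁻⟧
    (card-signed-⟦⟧ q [] 4 Fs (toWitness {a? = allSeparated? [] (signedSumsᶠ 4 Fs)} tt))
    where Fs = A₁ ∷ A₂ ∷ A₃ ∷ A₄⁻ ∷ []

  card-signed-A₄ : ⟦ A₄ ⟧ q ≢ a₃+a₂+a₁ → ⟦ A₄ ⟧ q ≢ a₃+a₂-a₁ →
    card-signed-A (⟦ A₄ ⟧ q) ≡ 16
  card-signed-A₄ ≢⁺ ≢⁻ = card-signed-⟦⟧ q (≢0 A₄⁺ ⟦A₄⁺⟧ ≢⁺ ∷ ≢0 A₄⁻ ⟦A₄⁻⟧ ≢⁻ ∷ []) 4 Fs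
    (toWitness {a? = allSeparated? (A₄ ⊖ A₄⁺ ∷ A₄ ⊖ A₄⁻ ∷ []) (signedSumsᶠ 4 Fs)} tt)
    where
    Fs = A₁ ∷ A₂ ∷ A₃ ∷ A₄ ∷ []
    ≢0 : ∀ G {a} → ⟦ G ⟧ q ≡ a → ⟦ A₄ ⟧ q ≢ a → ⟦ A₄ ⊖ G ⟧ q ≢ + 0
    ≢0 G refl ≢a eq = ≢a (i-j≡0⇒i≡j _ _ (trans (sym (⟦⟧-⊖ q A₄ G)) eq))

  card≡15⇔ : ∀ {a₁ a₂ a₃ a₄} →
    a₁ ≡ ⟦ A₁ ⟧ q → a₂ ≡ ⟦ A₂ ⟧ q → a₃ ≡ ⟦ A₃ ⟧ q → a₄ ≡ ⟦ A₄ ⟧ q →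
    (card-signed 4 (a₁ ∷ a₂ ∷ a₃ ∷ a₄ ∷ []) ≡ 15) ⇔ (a₄ ≡ a₃ + a₂ + a₁ ⊎ a₄ ≡ a₃ + a₂ - a₁)
  card≡15⇔ refl refl refl refl = mk⇔
    (λ card≡15 → decidable-stable (⟦ A₄ ⟧ q ≟ a₃+a₂+a₁ ⊎-dec ⟦ A₄ ⟧ q ≟ a₃+a₂-a₁)
      λ neither →
      15≢16 (trans (sym card≡15) (card-signed-A₄ (neither ∘ inj₁) (neither ∘ inj₂))))
    [ (λ eq → subst (λ a → card-signed-A a ≡ 15) (sym eq) card-signed-A₄⁺)
    , (λ eq → subst (λ a → card-signed-A a ≡ 15) (sym eq) card-signed-A₄⁻) ]
    where
    15≢16 : 15 ≢ 16
    15≢16 ()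

≈set-∷ʳ⇔ : ∀ {xs a b} → a ∉ xs → (xs ∷ʳ a) ≈set (xs ∷ʳ b) ⇔ a ≡ b
≈set-∷ʳ⇔ {xs} {a} {b} a∉xs = mk⇔ to from
  where
  to : (xs ∷ʳ a) ≈set (xs ∷ʳ b) → a ≡ b
  to (⊆ , _) with ∈-++⁻ xs (⊆ a (∈-++⁺ʳ xs (here refl)))
  ... | inj₁ a∈xs       = contradiction a∈xs a∉xs
  ... | inj₂ (here a≡b) = a≡b
  from : a ≡ b → (xs ∷ʳ a) ≈set (xs ∷ʳ b)
  from refl = (λ _ x∈ → x∈) , (λ _ x∈ → x∈)

>-∉ : ∀ {a xs} → All (_< a) xs → a ∉ xs
>-∉ = All¬⇒¬Any ∘ All.map (λ x<a → ≢-sym (<⇒≢ x<a))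

lemma4 : (a₁ a₂ a₃ a₄ : ℤ) →
    (∃ λ k₁ → a₁ ≡ + 2 * k₁ + + 1) → (∃ λ k₂ → a₂ ≡ + 2 * k₂ + + 1) →
    (∃ λ k₃ → a₃ ≡ + 2 * k₃ + + 1) → (∃ λ k₄ → a₄ ≡ + 2 * k₄ + + 1) →
    + 0 < a₁ → a₁ < a₂ → a₂ < a₃ → a₃ < a₄ →
    (card-signed 4 (a₁ ∷ a₂ ∷ a₃ ∷ a₄ ∷ []) ≡ 15) ⇔
      ((a₁ ∷ a₂ ∷ a₃ ∷ a₄ ∷ []) ≈set (a₁ ∷ a₂ ∷ a₃ ∷ a₃ + a₂ + a₁ ∷ [])
       ⊎ (a₁ ∷ a₂ ∷ a₃ ∷ a₄ ∷ []) ≈set (a₁ ∷ a₂ ∷ a₃ ∷ a₃ + a₂ - a₁ ∷ []))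
lemma4 a₁ a₂ a₃ a₄ odd₁ odd₂ odd₃ odd₄ 0<a₁ a₁<a₂ a₂<a₃ a₃<a₄
  with q , e₁ , e₂ , e₃ , e₄ ←
         odd-increasing-parametrisation odd₁ odd₂ odd₃ odd₄ 0<a₁ a₁<a₂ a₂<a₃ a₃<a₄
  = ⇔-trans (card≡15⇔ q e₁ e₂ e₃ e₄) (⇔-sym (≈set-∷ʳ⇔ a₄∉ ⊎-⇔ ≈set-∷ʳ⇔ a₄∉))
  where
  a₄∉ : a₄ ∉ a₁ ∷ a₂ ∷ a₃ ∷ []
  a₄∉ = >-∉ (<-trans a₁<a₂ (<-trans a₂<a₃ a₃<a₄) ∷ <-trans a₂<a₃ a₃<a₄ ∷ a₃<a₄ ∷ [])
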